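{- Simultaneous self-subsumption is symmetry-preserving: for every CNF formula $F$, with $F':=R(F)$, we have $\mathrm{Aut}_{\mathrm{syn}}(F)_{\{\mathrm{Lit}(F')\}}=\mathrm{Aut}_{\mathrm{syn}}(F)$ and $\mathrm{Aut}_{\mathrm{syn}}(F)\downarrow_{\mathrm{Lit}(F')}\subseteq\mathrm{Aut}_{\mathrm{syn}}(F')$.
   Context: Literals: each variable $v$ gives literals $v,\bar v$ with $\bar{\bar v}=v$. A CNF formula $F$ is a finite set of clauses, each a finite set of literals; $\mathrm{Var}(F)$ is the set of variables occurring in $F$, $\mathrm{Lit}(F):=\mathrm{Var}(F)\cup\{\bar v:v\in\mathrm{Var}(F)\}$. Bijections of literals act elementwise on clauses and formulas. A syntactic symmetry of $F$ is a bijection $\varphi:\mathrm{Lit}(F)\to\mathrm{Lit}(F)$ with $\varphi(F)=F$ and $\overline{\varphi(l)}=\varphi(\bar l)$ for all $l$; these form the group $\mathrm{Aut}_{\mathrm{syn}}(F)$. For a permutation group $\Gamma$ on $\Omega$ and $\Omega'\subseteq\Omega$: $\Gamma_{\{\Omega'\}}:=\{\varphi\in\Gamma:\varphi(\Omega')=\Omega'\}$ and $\Gamma\downarrow_{\Omega'}:=\{\varphi|_{\Omega'}:\varphi\in\Gamma_{\{\Omega'\}}\}$. Self-subsuming resolution: for clauses $A,B\in F$ and a literal $x$, write $f_F(A,B,x)$ if $x\in B$, $\bar x\in A$ and $A\setminus\{\bar x\}\subsetneq B\setminus\{x\}$ (i.e. from $A=C_1\cup\{\bar x\}$ and $B=C_2\cup\{x\}$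 with $C_1\subsetneq C_2$ one may replace $B$ by $B\setminus\{x\}$). Unique self-subsuming resolution is applicable to a clause $B\in F$ with literal $x$ if there is $A\in F$ with $f_F(A,B,x)$, and for all literals $x'$ and all $A'\in F$, $f_F(A',B,x')$ implies $x'=x$. Define $r_F(B):=B\setminus\{x\}$ if unique self-subsuming resolution is applicable to $B$ with literal $x$, and $r_F(B):=B$ otherwise. Simultaneous self-subsumption is the transformation $F\mapsto R(F):=\{r_F(C):C\in F\}$. -}

module Defs where

open import Data.Nat using (ℕ)
import Data.Nat.Properties as ℕP
open import Data.List using (List; []; _∷_; map; filter)
open import Data.List.Membership.Propositional using (_∈_; _∉_)
open import Data.List.Membership.DecPropositional using () renaming (_∈?_ to ∈?-gen)
open import Data.List.Relation.Unary.All as All using (All)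
open import Data.List.Relation.Unary.Any as Any using (Any; any?)
open import Data.Product using (Σ; ∃; ∃-syntax; _×_; _,_)
open import Data.Sum using (_⊎_)
open import Data.Bool using (Bool; if_then_else_)
open import Relation.Nullary using (¬_; Dec; yes; no; does)
open import Relation.Nullary.Decidable using (_×-dec_; _⊎-dec_; ¬?)
open import Relation.Binary.PropositionalEquality using (_≡_; refl; cong)
open import Relation.Binary.Definitions using (DecidableEquality)
open import Function.Bundles using (_⇔_)

data Lit : Set where
  pos : ℕ → Lit
  neg : ℕ → Lit

~_ : Lit → Lit
~ pos v = neg v
~ neg v = pos v

_≟L_ : DecidableEquality Lit
pos a ≟L pos b with a ℕP.≟ b
... | yes refl = yes refl
... | no a≢b = no λ { refl → a≢b refl }
pos a ≟L neg b = no λ ()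
neg a ≟L pos b = no λ ()
neg a ≟L neg b with a ℕP.≟ b
... | yes refl = yes refl
... | no a≢b = no λ { refl → a≢b refl }

_∈?_ : (l : Lit) (C : List Lit) → Dec (l ∈ C)
_∈?_ = ∈?-gen _≟L_

-- A clause is a finite set of literals, represented
-- by a list (only membership matters); a CNF formula is a finite set of
-- clauses, represented by a list of clauses, where clauses are compared
-- as sets.

Clause : Set
Clause = List Lit

CNF : Set
CNF = List Clause

_≋_ : Clause → Clause → Set
C ≋ D = ∀ l → (l ∈ C) ⇔ (l ∈ D)

_∈F_ : Clause → CNF → Set
C ∈F F = ∃[ D ] (D ∈ F × C ≋ D)

_≐_ : CNF → CNF → Set
F ≐ G = ∀ C → (C ∈F F) ⇔ (C ∈F G)

_∈Lit_ : Lit → CNF → Set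
l ∈Lit F = ∃[ C ] (C ∈ F × (l ∈ C ⊎ (~ l) ∈ C))

-- A bijection Lit(F) → Lit(F) is
-- represented by a function Lit → Lit whose restriction to Lit(F) is a
-- bijection of Lit(F); functions agreeing on Lit(F) represent the same
-- bijection, and all predicates below only depend on values on Lit(F).

actC : (Lit → Lit) → Clause → Clause
actC φ C = map φ C

actF : (Lit → Lit) → CNF → CNF
actF φ F = map (actC φ) F

SetwiseStabilizes : (Lit → Set) → (Lit → Lit) → Set
SetwiseStabilizes Ω φ =
  (∀ l → Ω l → Ω (φ l)) × (∀ l → Ω l → ∃[ k ] (Ω k × φ k ≡ l))

IsBijectionOn : (Lit → Set) → (Lit → Lit) → Set
IsBijectionOn Ω φ =
  SetwiseStabilizes Ω φ × (∀ l k → Ω l → Ω k → φ l ≡ φ k → l ≡ k)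

IsSynSym : CNF → (Lit → Lit) → Set
IsSynSym F φ =
  IsBijectionOn (λ l → l ∈Lit F) φ
  × actF φ F ≐ F
  × (∀ l → l ∈Lit F → ~ (φ l) ≡ φ (~ l))

InStabilizer : CNF → (Lit → Set) → (Lit → Lit) → Set
InStabilizer F Ω φ = IsSynSym F φ × SetwiseStabilizes Ω φ

StrictSub : Clause → Lit → Clause → Lit → Set
StrictSub A a B b =
  All (λ l → ¬ l ≡ a → (l ∈ B × ¬ l ≡ b)) A
  × Any (λ l → ¬ l ≡ b × ¬ (l ∈ A × ¬ l ≡ a)) B

f : Clause → Clause → Lit → Set
f A B x = x ∈ B × (~ x) ∈ A × StrictSub A (~ x) B x

strictSub? : ∀ A a B b → Dec (StrictSub A a B b)
strictSub? A a B b =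
  All.all? (λ l → dimp l) A
  ×-dec Any.any? (λ l → ¬? (l ≟L b) ×-dec ¬? ((l ∈? A) ×-dec ¬? (l ≟L a))) B
  where
  dimp : ∀ l → Dec (¬ l ≡ a → (l ∈ B × ¬ l ≡ b))
  dimp l with l ≟L a
  ... | yes p = yes λ ¬p → Data.Empty.⊥-elim (¬p p)
    where import Data.Empty
  ... | no ¬p with (l ∈? B) ×-dec ¬? (l ≟L b)
  ...   | yes q = yes λ _ → q
  ...   | no ¬q = no λ h → ¬q (h ¬p)

f? : ∀ A B x → Dec (f A B x)
f? A B x = (x ∈? B) ×-dec ((~ x) ∈? A) ×-dec strictSub? A (~ x) B x

-- literals x such that some A ∈ F has f_F(A,B,x); every such x lies in B,
-- so filtering B lists all of them (possibly with repetitions)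
candidates : CNF → Clause → List Lit
candidates F B = filter (λ x → any? (λ A → f? A B x) F) B

-- r_F(B): remove x if x is the unique such literal, otherwise keep B
allEq : Lit → List Lit → Bool
allEq x [] = Bool.true
  where import Data.Bool as Bool
allEq x (y ∷ ys) = if does (x ≟L y) then allEq x ys else Data.Bool.false
  where import Data.Bool

r : CNF → Clause → Clause
r F B with candidates F B
... | [] = B
... | x ∷ xs = if allEq x xs then filter (λ l → ¬? (l ≟L x)) B else B

R : CNF → CNF
R F = map (r F) F

-- A syntactic symmetry φ of F maps clauses of F to clauses of F and preserves
-- membership, complements and hence the relation "A self-subsumes B at x".
-- So x is the unique literal at which B can be strengthened iff φ x is the
-- unique one for φ(B), i.e. r_F(φ B) = φ(r_F B).  Thus φ permutes the clauses
-- of R(F), so it preserves R(F) and its literal set Lit(R F) ⊆ Lit(F).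
module Submission where

open import Defs
open import Data.Bool using (true; false)
open import Data.List using (List; []; _∷_; map)
open import Data.List.Membership.Propositional using (_∈_; find; lose)
open import Data.List.Membership.Propositional.Properties
  using (∈-map⁺; ∈-map⁻; ∈-filter⁺; ∈-filter⁻)
open import Data.List.Relation.Unary.All as All using ()
open import Data.List.Relation.Unary.Any using (here; there; any?)
open import Data.Product using (_×_; _,_; proj₁; proj₂; ∃-syntax)
import Data.Sum as Sum
open import Function using (_∘_)
open import Function.Bundles using (_⇔_; mk⇔; Equivalence)
import Function.Properties.Equivalence as ⇔
open import Relation.Nullary using (¬_; yes; no; ¬?)
open import Relation.Binary.PropositionalEquality
  using (_≡_; _≢_; refl; sym; trans; cong; subst; module ≡-Reasoning)

open Equivalence using (to; from)

~-involutive : ∀ l → ~ (~ l) ≡ l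
~-involutive (pos v) = refl
~-involutive (neg v) = refl

≋-refl : ∀ {C} → C ≋ C
≋-refl l = ⇔.refl

≋-sym : ∀ {C D} → C ≋ D → D ≋ C
≋-sym C≋D l = ⇔.sym (C≋D l)

≋-trans : ∀ {C D E} → C ≋ D → D ≋ E → C ≋ E
≋-trans C≋D D≋E l = ⇔.trans (C≋D l) (D≋E l)

∈Lit-of-∈ : ∀ {F B l} → B ∈ F → l ∈ B → l ∈Lit F
∈Lit-of-∈ B∈F l∈B = _ , B∈F , Sum.inj₁ l∈B

∈Lit-~ : ∀ {F l} → l ∈Lit F → (~ l) ∈Lit F
∈Lit-~ {l = l} (C , C∈F , Sum.inj₁ l∈C) =
  C , C∈F , Sum.inj₂ (subst (_∈ C) (sym (~-involutive l)) l∈C)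
∈Lit-~ (C , C∈F , Sum.inj₂ l̄∈C) = C , C∈F , Sum.inj₁ l̄∈C

StrictSubᵐ : Clause → Lit → Clause → Lit → Set
StrictSubᵐ A a B b =
  (∀ {l} → l ∈ A → l ≢ a → l ∈ B × l ≢ b)
  × ∃[ l ] (l ∈ B × l ≢ b × ¬ (l ∈ A × l ≢ a))

strictSub⇔ : ∀ {A a B b} → StrictSub A a B b ⇔ StrictSubᵐ A a B b
strictSub⇔ = mk⇔ (λ (A⊆B , B⊈A) → All.lookup A⊆B , find B⊈A)
                 (λ (A⊆B , l , l∈B , l∉A) → All.tabulate A⊆B , lose l∈B l∉A)

strictSubᵐ-resp-≋ : ∀ {A A' a B B' b} → A ≋ A' → B ≋ B' →
                    StrictSubᵐ A a B b → StrictSubᵐ A' a B' b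
strictSubᵐ-resp-≋ A≋A' B≋B' (A⊆B , l , l∈B , l≢b , l∉A) =
  (λ {k} k∈A' k≢a → let k∈B , k≢b = A⊆B (from (A≋A' k) k∈A') k≢a
                    in to (B≋B' k) k∈B , k≢b) ,
  l , to (B≋B' l) l∈B , l≢b , λ (l∈A' , l≢a) → l∉A (from (A≋A' l) l∈A' , l≢a)

f-resp-≋ : ∀ {A A' B B' x} → A ≋ A' → B ≋ B' → f A B x → f A' B' x
f-resp-≋ {x = x} A≋A' B≋B' (x∈B , x̄∈A , A⊂B) =
  to (B≋B' x) x∈B , to (A≋A' (~ x)) x̄∈A ,
  from strictSub⇔ (strictSubᵐ-resp-≋ A≋A' B≋B' (to strictSub⇔ A⊂B))

module InjectiveOn (Ω : Lit → Set) (φ : Lit → Lit)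
                   (injective : ∀ {l k} → Ω l → Ω k → φ l ≡ φ k → l ≡ k) where

  Within : Clause → Set
  Within C = ∀ {l} → l ∈ C → Ω l

  ∈-map⁻-injective : ∀ {B l} → Within B → Ω l → φ l ∈ map φ B → l ∈ B
  ∈-map⁻-injective ΩB Ωl φl∈φB with ∈-map⁻ φ φl∈φB
  ... | k , k∈B , φl≡φk = subst (_∈ _) (sym (injective Ωl (ΩB k∈B) φl≡φk)) k∈B

  strictSubᵐ-map⇔ : ∀ {A a B b} → Within A → Within B → Ω a → Ω b →
    StrictSubᵐ A a B b ⇔ StrictSubᵐ (map φ A) (φ a) (map φ B) (φ b)
  strictSubᵐ-map⇔ {A} {a} {B} {b} ΩA ΩB Ωa Ωb = mk⇔ forth back
    where
    forth : StrictSubᵐ A a B b → StrictSubᵐ (map φ A) (φ a) (map φ B) (φ b)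
    forth (A⊆B , l , l∈B , l≢b , l∉A) =
      A⊆B' , φ l , ∈-map⁺ φ l∈B , l≢b ∘ injective (ΩB l∈B) Ωb ,
      λ (φl∈φA , φl≢φa) → l∉A (∈-map⁻-injective ΩA (ΩB l∈B) φl∈φA , φl≢φa ∘ cong φ)
      where
      A⊆B' : ∀ {k'} → k' ∈ map φ A → k' ≢ φ a → k' ∈ map φ B × k' ≢ φ b
      A⊆B' k'∈φA k'≢φa with ∈-map⁻ φ k'∈φA
      ... | k , k∈A , refl =
        let k∈B , k≢b = A⊆B k∈A (k'≢φa ∘ cong φ)
        in ∈-map⁺ φ k∈B , k≢b ∘ injective (ΩA k∈A) Ωb
    back : StrictSubᵐ (map φ A) (φ a) (map φ B) (φ b) → StrictSubᵐ A a B b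
    back (A⊆B' , l' , l'∈φB , l'≢φb , l'∉φA) with ∈-map⁻ φ l'∈φB
    ... | l , l∈B , refl =
      A⊆B , l , l∈B , l'≢φb ∘ cong φ ,
      λ (l∈A , l≢a) → l'∉φA (∈-map⁺ φ l∈A , l≢a ∘ injective (ΩB l∈B) Ωa)
      where
      A⊆B : ∀ {k} → k ∈ A → k ≢ a → k ∈ B × k ≢ b
      A⊆B k∈A k≢a =
        let φk∈φB , φk≢φb = A⊆B' (∈-map⁺ φ k∈A) (k≢a ∘ injective (ΩA k∈A) Ωa)
        in ∈-map⁻-injective ΩB (ΩA k∈A) φk∈φB , φk≢φb ∘ cong φ

  f-map⇔ : ∀ {A B x} → Within A → Within B → Ω x → Ω (~ x) → ~ φ x ≡ φ (~ x) →
           f A B x ⇔ f (map φ A) (map φ B) (φ x)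
  f-map⇔ {A} {B} {x} ΩA ΩB Ωx Ωx̄ ~φx≡φx̄ = mk⇔
    (λ (x∈B , x̄∈A , A⊂B) →
      ∈-map⁺ φ x∈B ,
      subst (_∈ map φ A) (sym ~φx≡φx̄) (∈-map⁺ φ x̄∈A) ,
      from strictSub⇔ (subst (λ c → StrictSubᵐ (map φ A) c (map φ B) (φ x)) (sym ~φx≡φx̄)
                             (to strictSubᵐ⇔ (to strictSub⇔ A⊂B))))
    (λ (φx∈φB , ~φx∈φA , φA⊂φB) →
      ∈-map⁻-injective ΩB Ωx φx∈φB ,
      ∈-map⁻-injective ΩA Ωx̄ (subst (_∈ map φ A) ~φx≡φx̄ ~φx∈φA) ,
      from strictSub⇔ (from strictSubᵐ⇔
        (subst (λ c → StrictSubᵐ (map φ A) c (map φ B) (φ x)) ~φx≡φx̄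
               (to strictSub⇔ φA⊂φB))))
    where
    strictSubᵐ⇔ = strictSubᵐ-map⇔ {A} {~ x} {B} {x} ΩA ΩB Ωx̄ Ωx

Subsumable : CNF → Clause → Lit → Set
Subsumable F B x = ∃[ A ] (A ∈ F × f A B x)

UniquelySubsumable : CNF → Clause → Lit → Set
UniquelySubsumable F B x = Subsumable F B x × (∀ y → Subsumable F B y → y ≡ x)

subsumable⇒∈ : ∀ {F B x} → Subsumable F B x → x ∈ B
subsumable⇒∈ (_ , _ , x∈B , _) = x∈B

subsumable-resp-≋ : ∀ {F B B' x} → B ≋ B' → Subsumable F B x → Subsumable F B' x
subsumable-resp-≋ B≋B' (A , A∈F , fABx) = A , A∈F , f-resp-≋ ≋-refl B≋B' fABx

uniquelySubsumable-resp-≋ : ∀ {F B B' x} → B ≋ B' →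
                            UniquelySubsumable F B x → UniquelySubsumable F B' x
uniquelySubsumable-resp-≋ B≋B' (sx , unique) =
  subsumable-resp-≋ B≋B' sx , λ y → unique y ∘ subsumable-resp-≋ (≋-sym B≋B')

∈-candidates⇔ : ∀ F B x → x ∈ candidates F B ⇔ Subsumable F B x
∈-candidates⇔ F B x = mk⇔
  (λ x∈cs → find (proj₂ (∈-filter⁻ P? {xs = B} x∈cs)))
  (λ (A , A∈F , fABx) → ∈-filter⁺ P? (proj₁ fABx) (lose A∈F fABx))
  where
  P? = λ x → any? (λ A → f? A B x) F

Sole : List Lit → Lit → Set
Sole xs x = x ∈ xs × (∀ y → y ∈ xs → y ≡ x)

sole-candidates⇔ : ∀ F B x → Sole (candidates F B) x ⇔ UniquelySubsumable F B x
sole-candidates⇔ F B x = mk⇔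
  (λ (x∈cs , sole) → to (cand x) x∈cs , λ y → sole y ∘ from (cand y))
  (λ (sx , unique) → from (cand x) sx , λ y → unique y ∘ to (cand y))
  where
  cand = ∈-candidates⇔ F B

allEq-true : ∀ {x} xs → allEq x xs ≡ true → ∀ {y} → y ∈ xs → x ≡ y
allEq-true {x} (z ∷ zs) eq y∈xs with x ≟L z | y∈xs
... | yes x≡z | here refl = x≡z
... | yes _   | there y∈zs = allEq-true zs eq y∈zs

allEq-false : ∀ {x} xs → allEq x xs ≡ false → ∃[ y ] (y ∈ xs × x ≢ y)
allEq-false {x} (z ∷ zs) eq with x ≟L z
... | no x≢z = z , here refl , x≢z
... | yes _ with allEq-false zs eq
...   | y , y∈zs , x≢y = y , there y∈zs , x≢y

∈-r⇔¬sole : ∀ F B l → l ∈ r F B ⇔ (l ∈ B × ¬ Sole (candidates F B) l)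
∈-r⇔¬sole F B l with candidates F B
... | [] = mk⇔ (λ l∈B → l∈B , λ ()) proj₁
... | x ∷ xs with allEq x xs in eq
...   | true = mk⇔
  (λ l∈B∖x → let l∈B , l≢x = ∈-filter⁻ (λ l → ¬? (l ≟L x)) l∈B∖x
             in l∈B , λ (_ , sole) → l≢x (sym (sole x (here refl))))
  (λ (l∈B , ¬sole) → ∈-filter⁺ (λ l → ¬? (l ≟L x)) l∈B λ { refl →
     ¬sole (here refl , λ { y (here y≡l) → y≡l ; y (there y∈xs) → sym (allEq-true xs eq y∈xs) }) })
...   | false = mk⇔ (λ l∈B → l∈B , ¬sole) proj₁
  where
  -- x and some y ≢ x both lie in the candidate list
  ¬sole : ¬ Sole (x ∷ xs) l
  ¬sole (_ , sole) =
    let y , y∈xs , x≢y = allEq-false xs eq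
    in x≢y (trans (sole x (here refl)) (sym (sole y (there y∈xs))))

∈-r⇔ : ∀ {F B l} → l ∈ r F B ⇔ (l ∈ B × ¬ UniquelySubsumable F B l)
∈-r⇔ {F} {B} {l} = ⇔.trans (∈-r⇔¬sole F B l)
  (mk⇔ (λ (l∈B , ¬sole) → l∈B , ¬sole ∘ from (sole-candidates⇔ F B l))
       (λ (l∈B , ¬u) → l∈B , ¬u ∘ to (sole-candidates⇔ F B l)))

r-⊆ : ∀ {F B l} → l ∈ r F B → l ∈ B
r-⊆ = proj₁ ∘ to ∈-r⇔

r-resp-≋ : ∀ F {B B'} → B ≋ B' → r F B ≋ r F B'
r-resp-≋ F B≋B' l =
  ⇔.trans ∈-r⇔ (⇔.trans (mk⇔ (move B≋B') (move (≋-sym B≋B'))) (⇔.sym ∈-r⇔))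
  where
  move : ∀ {C D} → C ≋ D → l ∈ C × ¬ UniquelySubsumable F C l
                         → l ∈ D × ¬ UniquelySubsumable F D l
  move C≋D (l∈C , ¬u) = to (C≋D l) l∈C , ¬u ∘ uniquelySubsumable-resp-≋ (≋-sym C≋D)

∈Lit-R⇒∈Lit : ∀ {F l} → l ∈Lit R F → l ∈Lit F
∈Lit-R⇒∈Lit {F} (C , C∈RF , l∈C) with ∈-map⁻ (r F) C∈RF
... | B , B∈F , refl = B , B∈F , Sum.map r-⊆ r-⊆ l∈C

module _ {φ : Lit → Lit} {F : CNF} (invariant : actF φ F ≐ F) where

  image : ∀ {A} → A ∈ F → ∃[ D ] (D ∈ F × map φ A ≋ D)
  image {A} A∈F = to (invariant (map φ A)) (map φ A , ∈-map⁺ (actC φ) A∈F , ≋-refl)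

  preimage : ∀ {D} → D ∈ F → ∃[ A ] (A ∈ F × D ≋ map φ A)
  preimage {D} D∈F with from (invariant D) (D , D∈F , ≋-refl)
  ... | E , E∈φF , D≋E with ∈-map⁻ (actC φ) E∈φF
  ...   | A , A∈F , refl = A , A∈F , D≋E

  map-invariant : (h : Clause → Clause) → (∀ {B B'} → B ≋ B' → h B ≋ h B') →
                  (∀ {B} → B ∈ F → h (map φ B) ≋ map φ (h B)) →
                  actF φ (map h F) ≐ map h F
  map-invariant h h-resp h-equivariant C = mk⇔ forth back
    where
    forth : C ∈F actF φ (map h F) → C ∈F map h F
    forth (E , E∈φhF , C≋E) with ∈-map⁻ (actC φ) E∈φhF
    ... | G , G∈hF , refl with ∈-map⁻ h G∈hF
    ...   | B , B∈F , refl =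
      let D , D∈F , φB≋D = image B∈F
      in h D , ∈-map⁺ h D∈F ,
         ≋-trans C≋E (≋-sym (≋-trans (h-resp (≋-sym φB≋D)) (h-equivariant B∈F)))
    back : C ∈F map h F → C ∈F actF φ (map h F)
    back (E , E∈hF , C≋E) with ∈-map⁻ h E∈hF
    ... | D , D∈F , refl =
      let B , B∈F , D≋φB = preimage D∈F
      in map φ (h B) , ∈-map⁺ (actC φ) (∈-map⁺ h B∈F) ,
         ≋-trans C≋E (≋-trans (h-resp D≋φB) (h-equivariant B∈F))

  invariant⇒stabilizes-Lit : (∀ l → l ∈Lit F → ~ φ l ≡ φ (~ l)) →
                             SetwiseStabilizes (_∈Lit F) φ
  invariant⇒stabilizes-Lit ~φ≡φ~ = forth , back
    where
    forth : ∀ l → l ∈Lit F → φ l ∈Lit F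
    forth l (C , C∈F , l∈C) =
      let D , D∈F , φC≋D = image C∈F
      in D , D∈F , Sum.map
        (λ l∈C → to (φC≋D (φ l)) (∈-map⁺ φ l∈C))
        (λ l̄∈C → to (φC≋D (~ φ l)) (subst (_∈ map φ C)
                   (sym (~φ≡φ~ l (C , C∈F , l∈C))) (∈-map⁺ φ l̄∈C)))
        l∈C
    back : ∀ l → l ∈Lit F → ∃[ k ] (k ∈Lit F × φ k ≡ l)
    back l (C , C∈F , l∈C) with preimage C∈F | l∈C
    ... | A , A∈F , C≋φA | Sum.inj₁ l∈C with ∈-map⁻ φ (to (C≋φA l) l∈C)
    ...   | k , k∈A , l≡φk = k , ∈Lit-of-∈ A∈F k∈A , sym l≡φk
    back l (C , C∈F , _) | A , A∈F , C≋φA | Sum.inj₂ l̄∈C with ∈-map⁻ φ (to (C≋φA (~ l)) l̄∈C)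
    ...   | k , k∈A , l̄≡φk = ~ k , ∈Lit-~ (∈Lit-of-∈ A∈F k∈A) , φk̄≡l
      where
      open ≡-Reasoning
      φk̄≡l : φ (~ k) ≡ l
      φk̄≡l = begin
        φ (~ k)   ≡⟨ sym (~φ≡φ~ k (∈Lit-of-∈ A∈F k∈A)) ⟩
        ~ φ k     ≡⟨ cong ~_ (sym l̄≡φk) ⟩
        ~ (~ l)   ≡⟨ ~-involutive l ⟩
        l         ∎

module Symmetry {F : CNF} {φ : Lit → Lit} (S : IsSynSym F φ) where

  injective : ∀ {l k} → l ∈Lit F → k ∈Lit F → φ l ≡ φ k → l ≡ k
  injective {l} {k} = proj₂ (proj₁ S) l k

  invariant : actF φ F ≐ F
  invariant = proj₁ (proj₂ S)

  ~φ≡φ~ : ∀ {l} → l ∈Lit F → ~ φ l ≡ φ (~ l)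
  ~φ≡φ~ {l} = proj₂ (proj₂ S) l

  open InjectiveOn (_∈Lit F) φ injective

  subsumable-map⇔ : ∀ {B x} → B ∈ F → x ∈Lit F →
                    Subsumable F B x ⇔ Subsumable F (map φ B) (φ x)
  subsumable-map⇔ B∈F x∈LitF = mk⇔
    (λ (A , A∈F , fABx) → let D , D∈F , φA≋D = image invariant A∈F
      in D , D∈F , f-resp-≋ φA≋D ≋-refl (to (f-map A∈F) fABx))
    (λ (A' , A'∈F , fA'φBφx) → let A , A∈F , A'≋φA = preimage invariant A'∈F
      in A , A∈F , from (f-map A∈F) (f-resp-≋ A'≋φA ≋-refl fA'φBφx))
    where
    f-map = λ {A} A∈F → f-map⇔ {A} (∈Lit-of-∈ A∈F) (∈Lit-of-∈ B∈F)
                          x∈LitF (∈Lit-~ x∈LitF) (~φ≡φ~ x∈LitF)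

  uniquelySubsumable-map⇔ : ∀ {B x} → B ∈ F → x ∈Lit F →
    UniquelySubsumable F B x ⇔ UniquelySubsumable F (map φ B) (φ x)
  uniquelySubsumable-map⇔ {B} {x} B∈F x∈LitF = mk⇔
    (λ (sx , unique) → to (subsumable-map⇔ B∈F x∈LitF) sx , λ z sz →
      let y , y∈B , z≡φy = ∈-map⁻ φ (subsumable⇒∈ sz)
          sy = from (subsumable-map⇔ B∈F (∈Lit-of-∈ B∈F y∈B))
                    (subst (Subsumable F (map φ B)) z≡φy sz)
      in trans z≡φy (cong φ (unique y sy)))
    (λ (sφx , unique) → from (subsumable-map⇔ B∈F x∈LitF) sφx , λ y sy →
      let y∈LitF = ∈Lit-of-∈ B∈F (subsumable⇒∈ sy)
      in injective y∈LitF x∈LitF (unique (φ y) (to (subsumable-map⇔ B∈F y∈LitF) sy)))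

  ∈-r-map⇔ : ∀ {B l} → B ∈ F → l ∈ B → φ l ∈ r F (map φ B) ⇔ l ∈ r F B
  ∈-r-map⇔ B∈F l∈B = ⇔.trans ∈-r⇔ (⇔.trans
    (mk⇔ (λ (_ , ¬u) → l∈B , ¬u ∘ to unique⇔)
         (λ (_ , ¬u) → ∈-map⁺ φ l∈B , ¬u ∘ from unique⇔))
    (⇔.sym ∈-r⇔))
    where
    unique⇔ = uniquelySubsumable-map⇔ B∈F (∈Lit-of-∈ B∈F l∈B)

  r-map≋ : ∀ {B} → B ∈ F → r F (map φ B) ≋ map φ (r F B)
  r-map≋ {B} B∈F l' = mk⇔ forth back
    where
    forth : l' ∈ r F (map φ B) → l' ∈ map φ (r F B)
    forth l'∈ with ∈-map⁻ φ (r-⊆ l'∈)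
    ... | l , l∈B , refl = ∈-map⁺ φ (to (∈-r-map⇔ B∈F l∈B) l'∈)
    back : l' ∈ map φ (r F B) → l' ∈ r F (map φ B)
    back l'∈ with ∈-map⁻ φ l'∈
    ... | l , l∈rB , refl = from (∈-r-map⇔ B∈F (r-⊆ l∈rB)) l∈rB

  isSynSym-R : IsSynSym (R F) φ
  isSynSym-R =
    (invariant⇒stabilizes-Lit R-invariant (λ l → ~φ≡φ~ ∘ ∈Lit-R⇒∈Lit) ,
     λ l k l∈ k∈ → injective (∈Lit-R⇒∈Lit l∈) (∈Lit-R⇒∈Lit k∈)) ,
    R-invariant , λ l → ~φ≡φ~ ∘ ∈Lit-R⇒∈Lit
    where
    R-invariant : actF φ (R F) ≐ R F
    R-invariant = map-invariant invariant (r F) (r-resp-≋ F) r-map≋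

lemma5 : (F : CNF) →
    (∀ φ → InStabilizer F (λ l → l ∈Lit R F) φ ⇔ IsSynSym F φ)
    × (∀ φ → InStabilizer F (λ l → l ∈Lit R F) φ → IsSynSym (R F) φ)
lemma5 F =
  (λ φ → mk⇔ proj₁ (λ S → S , proj₁ (proj₁ (Symmetry.isSynSym-R S)))) ,
  (λ φ (S , _) → Symmetry.isSynSym-R S)
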